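{- Let $(G,+)$ be an abelian group and let $n\le s<m$ be positive integers with $m<\lceil\log_2 p(G)\rceil/2$. Let $a\in G$ be nonzero, and let $S,S'\subseteq[m]_a$ with $|S|=|S'|=n$. Let $M=SM_m(a,S)$ or $M=\mathcal{P}_{n,s,m}(a)$. Then $M$ is matched to $SM_m(a,S')$ if and only if $SM_m(a,S')$ is isomorphic to the uniform matroid $U_{n,m}$.
   Context: $p(G)$ is the smallest cardinality of a nonzero finite subgroup of $G$, with $p(G)=\infty$ if none exists (so the condition on $m$ is vacuous for torsion-free $G$). Under this condition one fixes a total order $\preceq$ on $[2m]_a\cup\{0\}$ compatible with the group structure (for $x,y,z$ in the set, $x\preceq y$ implies $x+z\preceq y+z$ when these sums lie in the set). For positive integer $k$, $ka=a+\cdots+a$ ($k$ times) and $[k]_a=\{a,2a,\dots,ka\}$. Extended panhandle matroid: $\mathcal{P}_{n,s,m}(a)$ is the rank-$n$ matroid on ground set $[m]_a$ whose bases are the $n$-subsets $B\subseteq[m]_a$ with $|B\cap[s]_a|\ge n-1$. Extended Schubert matroid: for an $n$-subset $S\subseteq[m]_a$, $SM_m(a,S)$ is the rank-$n$ matroid on $[m]_a$ whose bases are the $n$-subsets $T\subseteq[m]_a$ such that the $i$-th smallest element of $T$ does not exceed the $i$-th smallest element of $S$ for each $1\le i\le n$ (with respect to $\preceq$ when $a$ is positive; for negative $a$ the analogous counterpart, i.e. comparing $ka$ by the index $k$). $U_{n,m}$ is the uniform matroid of rank $n$ on $m$ elements. Matchings: for matroids $M,N$ over $G$ (ground sets in $G$)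 of equal rank $n>0$, ordered bases $\{a_1,\dots,a_n\}$ of $M$ and $\{b_1,\dots,b_n\}$ of $N$ are matched if $a_i+b_i\notin E(M)$ for all $i$; $M$ is matched to $N$ if every basis of $M$ is matched to some basis of $N$. -}

module Defs where

open import Level using (Level)
open import Data.Nat as ℕ using (ℕ; zero; suc; _∸_)
open import Data.Fin as Fin using (Fin; toℕ)
open import Data.Fin.Subset using (Subset; _∈_; ∣_∣; _∩_)
open import Data.Fin.Subset.Properties using (_∈?_)
open import Data.List using (List; length; filter)
open import Data.List.Base using (allFin)
open import Data.List.Relation.Unary.Any using (Any)
open import Data.List.Relation.Unary.AllPairs using (AllPairs)
open import Data.List.Relation.Binary.Pointwise using (Pointwise)
open import Data.Vec using (tabulate; lookup)
open import Data.Product using (Σ; ∃; ∃-syntax; _×_)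
open import Function using (_∘_)
open import Function.Bundles using (_↔_; Inverse; _⇔_)
open import Function.Definitions using (Injective)
open import Relation.Nullary using (¬_)
open import Relation.Binary.PropositionalEquality using (_≡_)
open import Algebra.Bundles using (AbelianGroup)

module _ {c ℓ : Level} (G : AbelianGroup c ℓ) where
  open AbelianGroup G

  _·_ : ℕ → Carrier → Carrier
  zero · x = ε
  suc k · x = x ∙ (k · x)

  _∈G_ : Carrier → List Carrier → Set (c Level.⊔ ℓ)
  x ∈G L = Any (x ≈_) L

  -- L (a list of pairwise distinct elements) is exactly the carrier of a
  -- finite subgroup of G which is nonzero (contains an element ≠ 0).
  -- Its cardinality is  length L.
  IsNonzeroFiniteSubgroup : List Carrier → Set (c Level.⊔ ℓ)
  IsNonzeroFiniteSubgroup L =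
    AllPairs (λ x y → ¬ (x ≈ y)) L
    × (ε ∈G L)
    × (∀ x y → x ∈G L → y ∈G L → (x ∙ y) ∈G L)
    × (∀ x → x ∈G L → (x ⁻¹) ∈G L)
    × Any (λ x → ¬ (x ≈ ε)) L

-- Matroids on the ground set [m]_a = {a, 2a, ..., ma}.
-- The element (k+1)·a of [m]_a is encoded by the index k : Fin m.
-- All matroids occurring here have rank n and are given by their
-- set of bases (n-subsets of the ground set).

record Matroid (m n : ℕ) : Set₁ where
  field
    IsBasis : Subset m → Set

open Matroid public

elems : ∀ {m} → Subset m → List (Fin m)
elems {m} T = filter (_∈? T) (allFin m)

initSeg : ∀ {m} → ℕ → Subset m
initSeg s = tabulate (λ k → toℕ k ℕ.<ᵇ s)

SM : (m n : ℕ) → Subset m → Matroid m n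
SM m n S = record
  { IsBasis = λ T → (∣ T ∣ ≡ n) × Pointwise Fin._≤_ (elems T) (elems S) }

Panhandle : (n s m : ℕ) → Matroid m n
Panhandle n s m = record
  { IsBasis = λ B → (∣ B ∣ ≡ n) × (n ∸ 1 ℕ.≤ ∣ B ∩ initSeg s ∣) }

Uniform : (n m : ℕ) → Matroid m n
Uniform n m = record { IsBasis = λ B → ∣ B ∣ ≡ n }

image : ∀ {m} → (Fin m ↔ Fin m) → Subset m → Subset m
image σ T = tabulate (λ y → lookup T (Inverse.from σ y))

_≅_ : ∀ {m n} → Matroid m n → Matroid m n → Set
M ≅ N = ∃[ σ ] (∀ T → IsBasis M T ⇔ IsBasis N (image σ T))

Enumerates : ∀ {m n} → (Fin n → Fin m) → Subset m → Set
Enumerates f B = Injective _≡_ _≡_ f × (∀ x → x ∈ B ⇔ (∃[ i ] f i ≡ x))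

module _ {c ℓ : Level} (G : AbelianGroup c ℓ) (a : AbelianGroup.Carrier G) where
  open AbelianGroup G

  elt : ∀ {m} → Fin m → Carrier
  elt k = _·_ G (suc (toℕ k)) a

  InGround : (m : ℕ) → Carrier → Set ℓ
  InGround m g = ∃[ j ] (g ≈ elt {m} j)

  MatchedTo : ∀ {m n} → Matroid m n → Matroid m n → Set ℓ
  MatchedTo {m} {n} M N =
    ∀ B → IsBasis M B →
      ∃[ B' ] (IsBasis N B' ×
        ∃[ f ] ∃[ g ] (Enumerates {m} {n} f B × Enumerates g B' ×
          (∀ i → ¬ InGround m (elt (f i) ∙ elt (g i)))))

{-# OPTIONS --safe #-}
-- A cyclic subgroup of order d ≤ 2m would give ⌈log₂ d⌉ ≤ d ≤ 2m, so a has order > 2m; hence for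
-- 1 ≤ i, j ≤ m the sum ia + ja lies outside [m]_a exactly when i + j > m.
-- Both SM_m(a,S) and the panhandle matroid have [n]_a as a basis. A basis of SM_m(a,S') matched
-- with it must consist of multiples ja with j > m − n, i.e. be the top segment of [m]_a, and that
-- segment dominates every n-subset elementwise, so every n-subset is a basis: SM_m(a,S') is uniform.
-- Conversely, if SM_m(a,S') is uniform the top segment is a basis, and pairing the i-th smallest
-- element of any basis with the i-th largest element of the top segment makes every index sum exceed m.
module Submission where

open import Defs
open import Level using (Level; _⊔_)
open import Data.Bool using (Bool; true; false; if_then_else_)
open import Data.Bool.Properties using (T-≡)
open import Data.Nat using (ℕ; zero; suc; _+_; _*_; _∸_; _^_; _≤_; _<_; z≤n; s≤s; s≤s⁻¹; NonZero)
open import Data.Nat.Properties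
open import Data.Nat.DivMod using (_%_; _/_; _mod_; m≡m%n+[m/n]*n; m%n<n)
open import Data.Nat.Logarithm using (⌈log₂_⌉; ⌈log₂⌉-mono-≤; ⌈log₂2^n⌉≡n)
open import Data.Fin as Fin using (Fin; toℕ; fromℕ<; _↑ʳ_; opposite)
open import Data.Fin.Properties
  using (toℕ<n; toℕ≤pred[n]; toℕ-fromℕ<; toℕ-↑ʳ; ↑ʳ-injective; opposite-prop; opposite-involutive)
import Data.Fin.Properties as Finₚ
open import Data.Fin.Permutation using (flip)
open import Data.Fin.Subset using (Subset; _∈_; _⊆_; ∣_∣; _∩_; ⊤; inside; outside)
open import Data.Fin.Subset.Properties using (_∈?_; ∈⊤; ∣⊤∣≡n; ∣p∣≤n; x∈p∩q⁺; p⊆q⇒∣p∣≤∣q∣)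
open import Data.List using (List; []; _∷_; length; map; filter; tabulate)
open import Data.List.Properties using (length-tabulate)
import Data.List.Relation.Unary.Any as Any
import Data.List.Relation.Unary.Any.Properties as Any
import Data.List.Relation.Unary.AllPairs.Properties as AllPairs
open import Data.List.Relation.Binary.Pointwise as Pointwise using (Pointwise; []; _∷_)
open import Data.Vec using ([]; _∷_; here; there; lookup)
open import Data.Vec.Properties using (lookup∘tabulate; tabulate∘lookup; []=⇒lookup; lookup⇒[]=)
open import Data.Product using (Σ; ∃-syntax; _×_; _,_; proj₁)
open import Data.Sum using (inj₁; inj₂)
open import Function using (_∘_; id)
open import Function.Bundles using (_⇔_; _↔_; mk⇔; Equivalence; Inverse)
open import Function.Properties.Inverse using (↔-refl)
open import Relation.Nullary using (¬_; does; contradiction)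
open import Relation.Binary.PropositionalEquality
  using (_≡_; refl; sym; trans; cong; subst; subst₂; module ≡-Reasoning)
open import Algebra.Bundles using (AbelianGroup)
open import Algebra.Properties.CommutativeMonoid.Sum +-0-commutativeMonoid using (sum; sum-permute; sum-cong-≗)

open Equivalence using (to; from)

n<2^n : ∀ n → n < 2 ^ n
n<2^n zero    = s≤s z≤n
n<2^n (suc n) = +-mono-≤ (m^n>0 2 n) (≤-trans (n<2^n n) (m≤m+n (2 ^ n) 0))

⌈log₂n⌉≤n : ∀ n → ⌈log₂ n ⌉ ≤ n
⌈log₂n⌉≤n n = ≤-trans (⌈log₂⌉-mono-≤ (<⇒≤ (n<2^n n))) (≤-reflexive (⌈log₂2^n⌉≡n n))

module Multiples {c ℓ : Level} (G : AbelianGroup c ℓ) where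
  open AbelianGroup G renaming (refl to ≈-refl; sym to ≈-sym; trans to ≈-trans)
  open import Algebra.Properties.Group group using (identityʳ-unique; inverseʳ-unique)
  open import Relation.Binary.Reasoning.Setoid setoid

  infixr 8 _·ᴳ_
  _·ᴳ_ : ℕ → Carrier → Carrier
  _·ᴳ_ = _·_ G

  ·ᴳ-congˡ : ∀ {p q} x → p ≡ q → p ·ᴳ x ≈ q ·ᴳ x
  ·ᴳ-congˡ x p≡q = reflexive (cong (_·ᴳ x) p≡q)

  ·ᴳ-homo-+ : ∀ p q x → (p + q) ·ᴳ x ≈ p ·ᴳ x ∙ q ·ᴳ x
  ·ᴳ-homo-+ zero    q x = ≈-sym (identityˡ (q ·ᴳ x))
  ·ᴳ-homo-+ (suc p) q x = begin
    x ∙ (p + q) ·ᴳ x        ≈⟨ ∙-congˡ (·ᴳ-homo-+ p q x) ⟩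
    x ∙ (p ·ᴳ x ∙ q ·ᴳ x)   ≈⟨ assoc x _ _ ⟨
    x ∙ p ·ᴳ x ∙ q ·ᴳ x     ∎

  ·ᴳ-multiple-of-period : ∀ {d x} → d ·ᴳ x ≈ ε → ∀ q → (q * d) ·ᴳ x ≈ ε
  ·ᴳ-multiple-of-period             period zero    = ≈-refl
  ·ᴳ-multiple-of-period {d} {x} period (suc q) = begin
    (d + q * d) ·ᴳ x          ≈⟨ ·ᴳ-homo-+ d (q * d) x ⟩
    d ·ᴳ x ∙ (q * d) ·ᴳ x     ≈⟨ ∙-cong period (·ᴳ-multiple-of-period period q) ⟩
    ε ∙ ε                     ≈⟨ identityˡ ε ⟩
    ε                         ∎

  ·ᴳ-mod : ∀ {d x} .{{_ : NonZero d}} → d ·ᴳ x ≈ ε → ∀ k → k ·ᴳ x ≈ (k % d) ·ᴳ x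
  ·ᴳ-mod {d} {x} period k = begin
    k ·ᴳ x                                ≈⟨ ·ᴳ-congˡ x (m≡m%n+[m/n]*n k d) ⟩
    (k % d + (k / d) * d) ·ᴳ x            ≈⟨ ·ᴳ-homo-+ (k % d) _ x ⟩
    (k % d) ·ᴳ x ∙ ((k / d) * d) ·ᴳ x     ≈⟨ ∙-congˡ (·ᴳ-multiple-of-period period (k / d)) ⟩
    (k % d) ·ᴳ x ∙ ε                      ≈⟨ identityʳ _ ⟩
    (k % d) ·ᴳ x                          ∎

  OrderExceeds : ℕ → Carrier → Set ℓ
  OrderExceeds b x = ∀ d → 1 ≤ d → d ≤ b → ¬ (d ·ᴳ x ≈ ε)

  ·ᴳ-distinct : ∀ {b p q x} → OrderExceeds b x → p < q → q ≤ b → ¬ (p ·ᴳ x ≈ q ·ᴳ x)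
  ·ᴳ-distinct {p = p} {q} {x} order p<q q≤b p·x≈q·x =
    order (q ∸ p) (m<n⇒0<n∸m p<q) (≤-trans (m∸n≤m q p) q≤b) (identityʳ-unique (p ·ᴳ x) _ (begin
      p ·ᴳ x ∙ (q ∸ p) ·ᴳ x   ≈⟨ ·ᴳ-homo-+ p (q ∸ p) x ⟨
      (p + (q ∸ p)) ·ᴳ x      ≈⟨ ·ᴳ-congˡ x (m+[n∸m]≡n (<⇒≤ p<q)) ⟩
      q ·ᴳ x                  ≈⟨ p·x≈q·x ⟨
      p ·ᴳ x                  ∎))

  multiples : ℕ → Carrier → List Carrier
  multiples D x = tabulate {n = D} (λ i → toℕ i ·ᴳ x)

  length-multiples : ∀ D x → length (multiples D x) ≡ D
  length-multiples D x = length-tabulate (λ (i : Fin D) → toℕ i ·ᴳ x)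

  module _ {d x} (1≤d : 1 ≤ d) (order : OrderExceeds d x) (period : suc d ·ᴳ x ≈ ε) where

    private
      InMultiples : Carrier → Set (c ⊔ ℓ)
      InMultiples u = _∈G_ G u (multiples (suc d) x)

      ∈-resp-≈ : ∀ {u v} → u ≈ v → InMultiples v → InMultiples u
      ∈-resp-≈ u≈v = Any.map (≈-trans u≈v)

      ·ᴳ-∈multiples : ∀ k → InMultiples (k ·ᴳ x)
      ·ᴳ-∈multiples k = Any.tabulate⁺ {f = λ i → toℕ i ·ᴳ x} (k mod suc d)
        (≈-trans (·ᴳ-mod period k) (·ᴳ-congˡ x (sym (toℕ-fromℕ< (m%n<n k (suc d))))))

    multiples-isNonzeroFiniteSubgroup : IsNonzeroFiniteSubgroup G (multiples (suc d) x)
    multiples-isNonzeroFiniteSubgroup =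
        AllPairs.tabulate⁺-< (λ {i} {j} i<j → ·ᴳ-distinct order i<j (toℕ≤pred[n] j))
      , ·ᴳ-∈multiples 0
      , closed-∙
      , closed-⁻¹
      , Any.map (λ x≈y y≈ε → order 1 ≤-refl 1≤d (≈-trans x≈y y≈ε)) (·ᴳ-∈multiples 1)
      where
      closed-∙ : ∀ u v → InMultiples u → InMultiples v → InMultiples (u ∙ v)
      closed-∙ u v u∈ v∈ with Any.tabulate⁻ u∈ | Any.tabulate⁻ v∈
      ... | i , u≈ | j , v≈ = ∈-resp-≈ (≈-trans (∙-cong u≈ v≈) (≈-sym (·ᴳ-homo-+ (toℕ i) (toℕ j) x)))
                                       (·ᴳ-∈multiples (toℕ i + toℕ j))
      closed-⁻¹ : ∀ u → InMultiples u → InMultiples (u ⁻¹)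
      closed-⁻¹ u u∈ with Any.tabulate⁻ u∈
      ... | i , u≈ = ∈-resp-≈ (≈-sym (≈-trans (inverseʳ-unique _ _ cancels) (⁻¹-cong (≈-sym u≈))))
                               (·ᴳ-∈multiples (suc d ∸ toℕ i))
        where
        cancels : toℕ i ·ᴳ x ∙ (suc d ∸ toℕ i) ·ᴳ x ≈ ε
        cancels = ≈-trans (≈-sym (·ᴳ-homo-+ (toℕ i) _ x))
                        (≈-trans (·ᴳ-congˡ x (m+[n∸m]≡n (<⇒≤ (toℕ<n i)))) period)

  orderExceeds-suc : ∀ {d x} → OrderExceeds d x → ¬ (suc d ·ᴳ x ≈ ε) → OrderExceeds (suc d) x
  orderExceeds-suc order period e 1≤e e≤1+d with m≤n⇒m<n∨m≡n e≤1+d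
  ... | inj₁ e≤d = order e 1≤e (s≤s⁻¹ e≤d)
  ... | inj₂ refl = period

  module _ {b x} (subgroup-bound : ∀ L → IsNonzeroFiniteSubgroup G L → b < ⌈log₂ (length L) ⌉)
         (x≉ε : ¬ (x ≈ ε)) where

    private
      no-period-below : ∀ d → suc d ≤ b → OrderExceeds d x → ¬ (suc d ·ᴳ x ≈ ε)
      no-period-below zero          _     _     x∙ε≈ε  = x≉ε (≈-trans (≈-sym (identityʳ x)) x∙ε≈ε)
      no-period-below d@(suc _) 1+d≤b order period =
        <⇒≱ (subgroup-bound _ (multiples-isNonzeroFiniteSubgroup (s≤s z≤n) order period))
            (≤-trans (≤-reflexive (cong ⌈log₂_⌉ (length-multiples (suc d) x)))
                     (≤-trans (⌈log₂n⌉≤n (suc d)) 1+d≤b))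

      orderExceeds-below : ∀ d → d ≤ b → OrderExceeds d x
      orderExceeds-below zero    _   e 1≤e e≤0 _ = <⇒≱ 1≤e e≤0
      orderExceeds-below (suc d) 1+d≤b = orderExceeds-suc order (no-period-below d 1+d≤b order)
        where
        order : OrderExceeds d x
        order = orderExceeds-below d (<⇒≤ 1+d≤b)

    orderExceeds : OrderExceeds b x
    orderExceeds = orderExceeds-below b ≤-refl

infix 4 _≤*_
_≤*_ : List ℕ → List ℕ → Set
_≤*_ = Pointwise _≤_

≤*-trans : ∀ {xs ys zs} → xs ≤* ys → ys ≤* zs → xs ≤* zs
≤*-trans = Pointwise.transitive ≤-trans

map-suc-≤* : ∀ {xs ys} → xs ≤* ys → map suc xs ≤* map suc ys
map-suc-≤* = Pointwise.map⁺ suc suc ∘ Pointwise.map s≤s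

range : ℕ → ℕ → List ℕ
range s zero    = []
range s (suc n) = s ∷ range (suc s) n

map-suc-range : ∀ s n → map suc (range s n) ≡ range (suc s) n
map-suc-range s zero    = refl
map-suc-range s (suc n) = cong (suc s ∷_) (map-suc-range (suc s) n)

map-suc-≤*-range : ∀ {xs} s n → xs ≤* range s n → map suc xs ≤* range (suc s) n
map-suc-≤*-range {xs} s n = subst (map suc xs ≤*_) (map-suc-range s n) ∘ map-suc-≤*

range-≤*-map-suc : ∀ {xs} s n → range s n ≤* xs → range (suc s) n ≤* map suc xs
range-≤*-map-suc {xs} s n = subst (_≤* map suc xs) (map-suc-range s n) ∘ map-suc-≤*

range-≤*-suc : ∀ s n → range s n ≤* range (suc s) n
range-≤*-suc s zero    = []
range-≤*-suc s (suc n) = n≤1+n s ∷ range-≤*-suc (suc s) n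

indices : ∀ {m} → Subset m → List ℕ
indices []            = []
indices (inside ∷ T)  = 0 ∷ map suc (indices T)
indices (outside ∷ T) = map suc (indices T)

map-toℕ-filter-∈?-∷ : ∀ {j m} b (T : Subset m) (h : Fin j → Fin m) →
  map toℕ (filter (_∈? (b ∷ T)) (tabulate (Fin.suc ∘ h)))
    ≡ map suc (map toℕ (filter (_∈? T) (tabulate h)))
map-toℕ-filter-∈?-∷ {zero}  b T h = refl
map-toℕ-filter-∈?-∷ {suc j} b T h with does (h Fin.zero ∈? T)
... | true  = cong (suc (toℕ (h Fin.zero)) ∷_) (map-toℕ-filter-∈?-∷ b T (h ∘ Fin.suc))
... | false = map-toℕ-filter-∈?-∷ b T (h ∘ Fin.suc)

map-toℕ-elems : ∀ {m} (T : Subset m) → map toℕ (elems T) ≡ indices T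
map-toℕ-elems []            = refl
map-toℕ-elems (inside ∷ T)  =
  cong (0 ∷_) (trans (map-toℕ-filter-∈?-∷ inside T id) (cong (map suc) (map-toℕ-elems T)))
map-toℕ-elems (outside ∷ T) =
  trans (map-toℕ-filter-∈?-∷ outside T id) (cong (map suc) (map-toℕ-elems T))

elems-≤⇔indices-≤* : ∀ {m} {T U : Subset m} →
  Pointwise Fin._≤_ (elems T) (elems U) ⇔ indices T ≤* indices U
elems-≤⇔indices-≤* {T = T} {U} = mk⇔
  (λ T≤U → subst₂ _≤*_ (map-toℕ-elems T) (map-toℕ-elems U) (Pointwise.map⁺ toℕ toℕ T≤U))
  (λ T≤U → Pointwise.map⁻ toℕ toℕ (subst₂ _≤*_ (sym (map-toℕ-elems T)) (sym (map-toℕ-elems U)) T≤U))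

indices-≤*-range : ∀ {m} (T : Subset m) → indices T ≤* range (m ∸ ∣ T ∣) ∣ T ∣
indices-≤*-range []            = []
indices-≤*-range (inside ∷ T)  = z≤n ∷ map-suc-≤*-range _ ∣ T ∣ (indices-≤*-range T)
indices-≤*-range {suc m} (outside ∷ T) rewrite +-∸-assoc 1 (∣p∣≤n T) =
  map-suc-≤*-range _ ∣ T ∣ (indices-≤*-range T)

range-≤*-indices : ∀ {m} s (T : Subset m) → (∀ {x} → x ∈ T → s ≤ toℕ x) → range s ∣ T ∣ ≤* indices T
range-≤*-indices s       []            _   = []
range-≤*-indices zero    (inside ∷ T)  _   = z≤n ∷ range-≤*-map-suc 0 ∣ T ∣ (range-≤*-indices 0 T (λ _ → z≤n))
range-≤*-indices (suc s) (inside ∷ T)  low = contradiction (low here) λ ()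
range-≤*-indices zero    (outside ∷ T) _   =
  ≤*-trans (range-≤*-suc 0 ∣ T ∣) (range-≤*-map-suc 0 ∣ T ∣ (range-≤*-indices 0 T (λ _ → z≤n)))
range-≤*-indices (suc s) (outside ∷ T) low =
  range-≤*-map-suc s ∣ T ∣ (range-≤*-indices s T (s≤s⁻¹ ∘ low ∘ there))

∈initSeg⇔< : ∀ {m t} {x : Fin m} → x ∈ initSeg t ⇔ toℕ x < t
∈initSeg⇔< {t = t} {x} = mk⇔
  (λ x∈ → <ᵇ⇒< _ t (from T-≡ (trans (sym (lookup∘tabulate _ x)) ([]=⇒lookup x∈))))
  (λ x<t → lookup⇒[]= x _ (trans (lookup∘tabulate _ x) (to T-≡ (<⇒<ᵇ x<t))))

initSeg-mono : ∀ {m t u} → t ≤ u → initSeg {m} t ⊆ initSeg u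
initSeg-mono t≤u x∈ = from ∈initSeg⇔< (<-≤-trans (to ∈initSeg⇔< x∈) t≤u)

∣initSeg∣ : ∀ {m} t → t ≤ m → ∣ initSeg {m} t ∣ ≡ t
∣initSeg∣ {zero}  zero    _         = refl
∣initSeg∣ {suc m} zero    _         = ∣initSeg∣ {m} zero z≤n
∣initSeg∣ {suc m} (suc t) (s≤s t≤m) = cong suc (∣initSeg∣ t t≤m)

indices-initSeg : ∀ {m} t → t ≤ m → indices (initSeg {m} t) ≡ range 0 t
indices-initSeg {zero}  zero    _         = refl
indices-initSeg {suc m} zero    _         = cong (map suc) (indices-initSeg {m} zero z≤n)
indices-initSeg {suc m} (suc t) (s≤s t≤m) =
  cong (0 ∷_) (trans (cong (map suc) (indices-initSeg t t≤m)) (map-suc-range 0 t))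

topSeg : ∀ k n → Subset (k + n)
topSeg zero    n = ⊤
topSeg (suc k) n = outside ∷ topSeg k n

∣topSeg∣ : ∀ k n → ∣ topSeg k n ∣ ≡ n
∣topSeg∣ zero    n = ∣⊤∣≡n n
∣topSeg∣ (suc k) n = ∣topSeg∣ k n

∈topSeg⇔ : ∀ {k n} {x : Fin (k + n)} → x ∈ topSeg k n ⇔ (∃[ j ] k ↑ʳ j ≡ x)
∈topSeg⇔ {zero}            = mk⇔ (λ _ → _ , refl) (λ _ → ∈⊤)
∈topSeg⇔ {suc k} {x = Fin.zero}  = mk⇔ (λ ()) (λ ())
∈topSeg⇔ {suc k} {x = Fin.suc x} = mk⇔
  (λ { (there x∈) → let j , eq = to ∈topSeg⇔ x∈ in j , cong Fin.suc eq })
  (λ (j , eq) → there (from ∈topSeg⇔ (j , Finₚ.suc-injective eq)))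

descending : ∀ k n → Fin n → Fin (k + n)
descending k n i = k ↑ʳ opposite i

toℕ-descending : ∀ k n (i : Fin n) → toℕ (descending k n i) ≡ k + (n ∸ suc (toℕ i))
toℕ-descending k n i = trans (toℕ-↑ʳ k (opposite i)) (cong (k +_) (opposite-prop i))

descending-enumerates-topSeg : ∀ k n → Enumerates (descending k n) (topSeg k n)
descending-enumerates-topSeg k n =
  injective , λ x → mk⇔ (onto x) (λ (i , eq) → from ∈topSeg⇔ (opposite i , eq))
  where
  injective : ∀ {i j} → descending k n i ≡ descending k n j → i ≡ j
  injective {i} {j} eq = trans (sym (opposite-involutive i))
    (trans (cong opposite (↑ʳ-injective k _ _ eq)) (opposite-involutive j))
  onto : ∀ x → x ∈ topSeg k n → ∃[ i ] descending k n i ≡ x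
  onto x x∈ = let j , eq = to ∈topSeg⇔ x∈
              in opposite j , trans (cong (k ↑ʳ_) (opposite-involutive j)) eq

enum : ∀ {m} (B : Subset m) → Fin ∣ B ∣ → Fin m
enum (inside ∷ B)  Fin.zero    = Fin.zero
enum (inside ∷ B)  (Fin.suc i) = Fin.suc (enum B i)
enum (outside ∷ B) i           = Fin.suc (enum B i)

enum-injective : ∀ {m} (B : Subset m) {i j} → enum B i ≡ enum B j → i ≡ j
enum-injective (inside ∷ B)  {Fin.zero}  {Fin.zero}  _  = refl
enum-injective (inside ∷ B)  {Fin.suc i} {Fin.suc j} eq = cong Fin.suc (enum-injective B (Finₚ.suc-injective eq))
enum-injective (outside ∷ B)                          eq = enum-injective B (Finₚ.suc-injective eq)

∈⇔enum : ∀ {m} (B : Subset m) {x} → x ∈ B ⇔ (∃[ i ] enum B i ≡ x)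
∈⇔enum (inside ∷ B)  {Fin.zero}  = mk⇔ (λ _ → Fin.zero , refl) (λ _ → here)
∈⇔enum (outside ∷ B) {Fin.zero}  = mk⇔ (λ ()) (λ ())
∈⇔enum (inside ∷ B)  {Fin.suc x} = mk⇔
  (λ { (there x∈) → let i , eq = to (∈⇔enum B) x∈ in Fin.suc i , cong Fin.suc eq })
  (λ { (Fin.suc i , eq) → there (from (∈⇔enum B) (i , Finₚ.suc-injective eq)) })
∈⇔enum (outside ∷ B) {Fin.suc x} = mk⇔
  (λ { (there x∈) → let i , eq = to (∈⇔enum B) x∈ in i , cong Fin.suc eq })
  (λ (i , eq) → there (from (∈⇔enum B) (i , Finₚ.suc-injective eq)))

toℕ≤toℕ-enum : ∀ {m} (B : Subset m) i → toℕ i ≤ toℕ (enum B i)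
toℕ≤toℕ-enum (inside ∷ B)  Fin.zero    = z≤n
toℕ≤toℕ-enum (inside ∷ B)  (Fin.suc i) = s≤s (toℕ≤toℕ-enum B i)
toℕ≤toℕ-enum (outside ∷ B) i           = m≤n⇒m≤1+n (toℕ≤toℕ-enum B i)

increasing-enumeration : ∀ {m n} (B : Subset m) → ∣ B ∣ ≡ n →
  Σ (Fin n → Fin m) λ f → Enumerates f B × (∀ i → toℕ i ≤ toℕ (f i))
increasing-enumeration B refl = enum B , (enum-injective B , λ _ → ∈⇔enum B) , toℕ≤toℕ-enum B

fromBool : Bool → ℕ
fromBool b = if b then 1 else 0

∣∣≡sum : ∀ {m} (T : Subset m) → ∣ T ∣ ≡ sum (fromBool ∘ lookup T)
∣∣≡sum []            = refl
∣∣≡sum (inside ∷ T)  = cong suc (∣∣≡sum T)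
∣∣≡sum (outside ∷ T) = ∣∣≡sum T

∣image∣ : ∀ {m} (σ : Fin m ↔ Fin m) (T : Subset m) → ∣ image σ T ∣ ≡ ∣ T ∣
∣image∣ σ T = begin
  ∣ image σ T ∣                             ≡⟨ ∣∣≡sum (image σ T) ⟩
  sum (fromBool ∘ lookup (image σ T))       ≡⟨ sum-cong-≗ (cong fromBool ∘ lookup∘tabulate (lookup T ∘ σ⁻¹)) ⟩
  sum (fromBool ∘ lookup T ∘ σ⁻¹)           ≡⟨ sum-permute (fromBool ∘ lookup T) (flip σ) ⟨
  sum (fromBool ∘ lookup T)                 ≡⟨ ∣∣≡sum T ⟨
  ∣ T ∣                                     ∎
  where
  open ≡-Reasoning
  σ⁻¹ : Fin _ → Fin _
  σ⁻¹ = Inverse.from σ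

≅Uniform⇔bases-are-n-subsets : ∀ {m n} {M : Matroid m n} →
  M ≅ Uniform n m ⇔ (∀ T → IsBasis M T ⇔ ∣ T ∣ ≡ n)
≅Uniform⇔bases-are-n-subsets {M = M} = mk⇔
  (λ (σ , φ) T → mk⇔ (λ T-basis → trans (sym (∣image∣ σ T)) (to (φ T) T-basis))
                     (λ ∣T∣≡n → from (φ T) (trans (∣image∣ σ T) ∣T∣≡n)))
  (λ bases → ↔-refl , λ T →
     subst (λ U → IsBasis M T ⇔ ∣ U ∣ ≡ _) (sym (tabulate∘lookup T)) (bases T))

high-basis⇒SM≅Uniform : ∀ {m n S B} → IsBasis (SM m n S) B → (∀ {y} → y ∈ B → m ∸ n ≤ toℕ y) →
  SM m n S ≅ Uniform n m
high-basis⇒SM≅Uniform {m} {B = B} (refl , B≤S) high =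
  from ≅Uniform⇔bases-are-n-subsets λ T → mk⇔ proj₁ λ ∣T∣≡n → ∣T∣≡n , from elems-≤⇔indices-≤* (
    ≤*-trans (subst (λ n → indices T ≤* range (m ∸ n) n) ∣T∣≡n (indices-≤*-range T))
   (≤*-trans (range-≤*-indices (m ∸ ∣ B ∣) B high)
             (to elems-≤⇔indices-≤* B≤S)))

initSeg-isBasis-SM : ∀ {m n S} → n ≤ m → ∣ S ∣ ≡ n → IsBasis (SM m n S) (initSeg n)
initSeg-isBasis-SM {S = S} n≤m refl = ∣initSeg∣ _ n≤m , from elems-≤⇔indices-≤*
  (subst (_≤* indices S) (sym (indices-initSeg _ n≤m)) (range-≤*-indices 0 S (λ _ → z≤n)))

initSeg-isBasis-Panhandle : ∀ {m n s} → n ≤ s → n ≤ m → IsBasis (Panhandle n s m) (initSeg n)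
initSeg-isBasis-Panhandle {m} {n} {s} n≤s n≤m = ∣initSeg∣ n n≤m , (begin
  n ∸ 1                               ≤⟨ m∸n≤m n 1 ⟩
  n                                   ≡⟨ ∣initSeg∣ n n≤m ⟨
  ∣ initSeg {m} n ∣                   ≤⟨ p⊆q⇒∣p∣≤∣q∣ {m} (λ x∈ → x∈p∩q⁺ (x∈ , initSeg-mono n≤s x∈)) ⟩
  ∣ initSeg {m} n ∩ initSeg s ∣       ∎)
  where open ≤-Reasoning

module Matching {c ℓ : Level} (G : AbelianGroup c ℓ) (a : AbelianGroup.Carrier G) where
  open AbelianGroup G using (_∙_) renaming (sym to ≈-sym; trans to ≈-trans)
  open Multiples G using (·ᴳ-congˡ; ·ᴳ-homo-+; ·ᴳ-distinct; OrderExceeds)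

  ∉ground⇒> : ∀ {m} (x y : Fin m) → ¬ InGround G a m (elt G a x ∙ elt G a y) →
    m < suc (toℕ x) + suc (toℕ y)
  ∉ground⇒> {m} x y ∉ground = ≰⇒> λ sum≤m → ∉ground
    (fromℕ< sum≤m , ≈-trans (≈-sym (·ᴳ-homo-+ (suc (toℕ x)) (suc (toℕ y)) a))
                            (·ᴳ-congˡ a (cong suc (sym (toℕ-fromℕ< sum≤m)))))

  >⇒∉ground : ∀ {m} (x y : Fin m) → OrderExceeds (2 * m) a → m < suc (toℕ x) + suc (toℕ y) →
    ¬ InGround G a m (elt G a x ∙ elt G a y)
  >⇒∉ground {m} x y order m<sum (j , sum≈j) =
    ·ᴳ-distinct order (≤-<-trans (toℕ<n j) m<sum) sum≤2m
      (≈-sym (≈-trans (·ᴳ-homo-+ (suc (toℕ x)) (suc (toℕ y)) a) sum≈j))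
    where
    sum≤2m : suc (toℕ x) + suc (toℕ y) ≤ 2 * m
    sum≤2m = ≤-trans (+-mono-≤ (toℕ<n x) (toℕ<n y)) (≤-reflexive (cong (m +_) (sym (+-identityʳ m))))

  matchedTo⇒high-basis : ∀ {m n} {M N : Matroid m n} → IsBasis M (initSeg n) → MatchedTo G a M N →
    ∃[ B ] IsBasis N B × (∀ {y} → y ∈ B → m ∸ n ≤ toℕ y)
  matchedTo⇒high-basis {m} {n} initSeg-basis matched
    with matched (initSeg n) initSeg-basis
  ... | B , B-basis , f , g , (_ , f-onto) , (_ , g-onto) , apart = B , B-basis , high
    where
    high : ∀ {y} → y ∈ B → m ∸ n ≤ toℕ y
    high y∈B with to (g-onto _) y∈B
    ... | i , refl = m≤n+o⇒m∸n≤o m n (begin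
      m                           ≤⟨ s≤s⁻¹ (∉ground⇒> (f i) (g i) (apart i)) ⟩
      toℕ (f i) + suc (toℕ (g i)) ≡⟨ +-suc (toℕ (f i)) (toℕ (g i)) ⟩
      suc (toℕ (f i)) + toℕ (g i) ≤⟨ +-monoˡ-≤ (toℕ (g i)) (to ∈initSeg⇔< (from (f-onto (f i)) (i , refl))) ⟩
      n + toℕ (g i)               ∎)
      where open ≤-Reasoning

  top-basis⇒matchedTo : ∀ {k n} {M N : Matroid (k + n) n} → OrderExceeds (2 * (k + n)) a →
    (∀ B → IsBasis M B → ∣ B ∣ ≡ n) → IsBasis N (topSeg k n) → MatchedTo G a M N
  top-basis⇒matchedTo {k} {n} order rank topSeg-basis B B-basis
    with increasing-enumeration B (rank B B-basis)
  ... | f , f-enumerates , i≤f =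
    topSeg k n , topSeg-basis , f , descending k n , f-enumerates , descending-enumerates-topSeg k n ,
    λ i → >⇒∉ground (f i) (descending k n i) order (sum-exceeds i)
    where
    sum-exceeds : ∀ i → k + n < suc (toℕ (f i)) + suc (toℕ (descending k n i))
    sum-exceeds i = begin-strict
      k + n                           ≡⟨ cong (k +_) (m∸n+n≡m (toℕ<n i)) ⟨
      k + (r + suc (toℕ i))           ≡⟨ +-assoc k r _ ⟨
      k + r + suc (toℕ i)             ≤⟨ +-monoʳ-≤ (k + r) (s≤s (i≤f i)) ⟩
      k + r + suc (toℕ (f i))         ≡⟨ +-comm (k + r) _ ⟩
      suc (toℕ (f i)) + (k + r)       <⟨ +-monoʳ-< (suc (toℕ (f i))) (n<1+n (k + r)) ⟩
      suc (toℕ (f i)) + suc (k + r)   ≡⟨ cong (λ z → suc (toℕ (f i)) + suc z) (toℕ-descending k n i) ⟨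
      suc (toℕ (f i)) + suc (toℕ (descending k n i)) ∎
      where
      open ≤-Reasoning
      r = n ∸ suc (toℕ i)

  matchedTo-SM⇔SM≅Uniform : ∀ {k n} {M : Matroid (k + n) n} (S : Subset (k + n)) →
    OrderExceeds (2 * (k + n)) a → IsBasis M (initSeg n) → (∀ B → IsBasis M B → ∣ B ∣ ≡ n) →
    MatchedTo G a M (SM (k + n) n S) ⇔ (SM (k + n) n S ≅ Uniform n (k + n))
  matchedTo-SM⇔SM≅Uniform {k} {n} S order initSeg-basis rank = mk⇔
    (λ matched → let B , B-basis , high = matchedTo⇒high-basis initSeg-basis matched
                 in high-basis⇒SM≅Uniform B-basis high)
    (λ uniform → top-basis⇒matchedTo order rank
                   (from (to ≅Uniform⇔bases-are-n-subsets uniform (topSeg k n)) (∣topSeg∣ k n)))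

theorem4p8 : {c ℓ : Level} (G : AbelianGroup c ℓ) (n s m : ℕ) →
    1 ≤ n → n ≤ s → s < m →
    (∀ (L : List (AbelianGroup.Carrier G)) → IsNonzeroFiniteSubgroup G L →
      2 * m < ⌈log₂ (length L) ⌉) →
    (a : AbelianGroup.Carrier G) → ¬ (AbelianGroup._≈_ G a (AbelianGroup.ε G)) →
    (S S' : Subset m) → ∣ S ∣ ≡ n → ∣ S' ∣ ≡ n →
    (MatchedTo G a (SM m n S) (SM m n S') ⇔ (SM m n S' ≅ Uniform n m))
    × (MatchedTo G a (Panhandle n s m) (SM m n S') ⇔ (SM m n S' ≅ Uniform n m))
theorem4p8 G n s m _ n≤s s<m subgroup-bound a a≉ε S S' ∣S∣≡n _
  -- writing m = k + n exhibits the top n elements as the segment topSeg k n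
  with m ∸ n | m∸n+n≡m (≤-trans n≤s (<⇒≤ s<m))
... | k | refl =
    matchedTo-SM⇔SM≅Uniform S' order (initSeg-isBasis-SM n≤m ∣S∣≡n) (λ _ → proj₁)
  , matchedTo-SM⇔SM≅Uniform S' order (initSeg-isBasis-Panhandle n≤s n≤m) (λ _ → proj₁)
  where
  open Matching G a

  n≤m : n ≤ k + n
  n≤m = m≤n+m n k

  order : Multiples.OrderExceeds G (2 * (k + n)) a
  order = Multiples.orderExceeds G subgroup-bound a≉ε
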